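{- Let $d\geq1$ and $m,n,q\geq1$ be integers with $(d,q)=1$ and $d\mid q^m-1$. Let $f=\mathrm{ord}_d(q)$ and let $\mathcal{P}$ be the proposition "$2\,\|\,d$, $q\equiv3\pmod 4$ and $f$ is odd". Then \[ (q^{mn}-1,d^\infty)=(q^m-1,d^\infty)\,(n,d^\infty)\cdot\begin{cases}2^{v_2(q^m+1)-1},&\text{if }\mathcal{P}\text{ holds and }2\mid n;\\ 1,&\text{otherwise}.\end{cases} \]
   Context: For integers $k,d$, $(k,d^\infty)=\prod_{l\mid d,\ l\text{ prime}}l^{v_l(k)}$, where $v_l$ is the $l$-adic valuation. $2\,\|\,d$ means $2\mid d$ and $4\nmid d$. $\mathrm{ord}_d(q)$ is the multiplicative order of $q$ modulo $d$. -}

module Defs where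

open import Data.Nat using (ℕ; zero; suc; _+_; _*_; _∸_; _^_; _≤_; _<_)
open import Data.Nat.Divisibility using (_∣_; _∣?_)
open import Data.Nat.DivMod using (_/_)
open import Data.Nat.Primality using (Prime; prime?)
open import Data.List using (List; upTo; filter; map)
open import Data.Nat.ListAction using (product)
open import Data.Product using (_×_)
open import Relation.Nullary using (¬_; yes; no; _×-dec_)

-- v_p(k) with fuel; for p ≥ 2 and k ≥ 1, taking fuel = k gives the
-- exact p-adic valuation (v_p(k) ≤ k).
valF : ℕ → ℕ → ℕ → ℕ
valF zero    p k = zero
valF (suc n) p zero = zero
valF (suc n) zero (suc k) = zero
valF (suc n) (suc zero) (suc k) = zero
valF (suc n) (suc (suc p)) (suc k) with suc (suc p) ∣? suc k
... | yes _ = suc (valF n (suc (suc p)) (suc k / suc (suc p)))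
... | no  _ = zero

-- l-adic valuation v_l(k)  (meaningful for prime l and k ≥ 1)
v : ℕ → ℕ → ℕ
v l k = valF k l k

-- primes l with l ∣ d, for d ≥ 1 (all such l lie in [0, d])
primeDivisors : ℕ → List ℕ
primeDivisors d = filter (λ l → prime? l ×-dec (l ∣? d)) (upTo (suc d))

dInf : ℕ → ℕ → ℕ
dInf k d = product (map (λ l → l ^ v l k) (primeDivisors d))

TwoExactly : ℕ → Set
TwoExactly d = (2 ∣ d) × ¬ (4 ∣ d)

IsOrd : ℕ → ℕ → ℕ → Set
IsOrd d q f = (1 ≤ f) × (d ∣ (q ^ f ∸ 1)) × (∀ g → 1 ≤ g → d ∣ (q ^ g ∸ 1) → f ≤ g)

-- Write q^m = 1 + b, so that q^(mn) - 1 = b (1 + x + ⋯ + x^(n-1)) with x = 1 + b, and use that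
-- (·, d^∞) is multiplicative. Every prime l ∣ d divides b, so by lifting the exponent the geometric
-- sum has the same l-adic valuation as n when l is odd or 4 ∣ b; it does too when l = 2 and n is
-- odd, both valuations being 0. If 2 ∣ d and n = 2k, the sum factors as (2 + b) times the sum of
-- length k for (1 + b)², and (1 + b)² - 1 = b (2 + b) is divisible by 4; as the odd primes of d
-- divide b, they do not divide 2 + b, so this factor contributes exactly 2^v₂(q^m + 1), while
-- (n, d^∞) = 2 (k, d^∞).
-- Finally, 2 ∣ d with 4 ∤ b forces 𝒫: q ≡ 3 (mod 4), hence m is odd, and f ∣ m.
{-# OPTIONS --safe #-}
module Submission where

open import Defs
open import Data.Nat.GCD using (gcd)
open import Data.Nat
open import Data.Nat.Properties
open import Data.Nat.Divisibility
open import Data.Nat.DivMod using (_/_; _%_; m/n*n≡m; m/n<m; m≡m%n+[m/n]*n; m%n<n)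
open import Data.Nat.Primality using (Prime; prime?; prime[2]; ¬prime[1]; euclidsLemma; prime⇒nonTrivial; prime⇒irreducible; irreducible[2])
open import Data.Nat.Tactic.RingSolver using (solve-∀)
open import Data.Nat.ListAction using (product)
open import Data.List using ([]; _∷_; map; upTo)
open import Data.List.Properties using (map-cong-local)
open import Data.List.Membership.Propositional using (_∈_)
open import Data.List.Membership.Propositional.Properties using (∈-filter⁺; ∈-upTo⁺)
open import Data.List.Relation.Unary.All as All using (All; []; _∷_)
open import Data.List.Relation.Unary.All.Properties using (all-filter)
open import Data.List.Relation.Unary.Any using (here; there)
open import Data.List.Relation.Unary.AllPairs using (_∷_)
open import Data.List.Relation.Unary.Unique.Propositional using (Unique)
import Data.List.Relation.Unary.Unique.Propositional.Properties as Unique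
open import Data.Product using (∃; _×_; _,_)
open import Data.Sum using (_⊎_; inj₁; inj₂; [_,_])
open import Relation.Nullary using (¬_; yes; no; contradiction; _×-dec_)
open import Relation.Binary.PropositionalEquality hiding ([_])
open import Function using (_∘_)

geomSum : ℕ → ℕ → ℕ
geomSum x zero    = 0
geomSum x (suc n) = 1 + x * geomSum x n

1≤geomSum : ∀ {x n} → 1 ≤ n → 1 ≤ geomSum x n
1≤geomSum {n = suc _} _ = s≤s z≤n

geomSum-+ : ∀ x a c → geomSum x (a + c) ≡ geomSum x a + x ^ a * geomSum x c
geomSum-+ x zero    c = sym (*-identityˡ (geomSum x c))
geomSum-+ x (suc a) c rewrite geomSum-+ x a c = lemma x (geomSum x a) (x ^ a) (geomSum x c)
  where
  lemma : ∀ x s p t → 1 + x * (s + p * t) ≡ 1 + x * s + x * p * t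
  lemma = solve-∀

geomSum-* : ∀ x a r → geomSum x (a * r) ≡ geomSum x a * geomSum (x ^ a) r
geomSum-* x a zero    rewrite *-zeroʳ a = sym (*-zeroʳ (geomSum x a))
geomSum-* x a (suc r) rewrite *-suc a r | geomSum-+ x a (a * r) | geomSum-* x a r =
  lemma (geomSum x a) (x ^ a) (geomSum (x ^ a) r)
  where
  lemma : ∀ s p t → s + p * (s * t) ≡ s * (1 + p * t)
  lemma = solve-∀

[1+b]^n≡1+b*geomSum : ∀ b n → (1 + b) ^ n ≡ 1 + b * geomSum (1 + b) n
[1+b]^n≡1+b*geomSum b zero    = cong suc (sym (*-zeroʳ b))
[1+b]^n≡1+b*geomSum b (suc n) = begin
  (1 + b) * (1 + b) ^ n                  ≡⟨ cong ((1 + b) *_) ([1+b]^n≡1+b*geomSum b n) ⟩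
  (1 + b) * (1 + b * geomSum (1 + b) n)  ≡⟨ lemma b (geomSum (1 + b) n) ⟩
  1 + b * geomSum (1 + b) (suc n)        ∎
  where
  open ≡-Reasoning
  lemma : ∀ b s → (1 + b) * (1 + b * s) ≡ 1 + b * (1 + (1 + b) * s)
  lemma = solve-∀

[1+a]^n≡1+b⇒a∣b : ∀ {a b} n → (1 + a) ^ n ≡ 1 + b → a ∣ b
[1+a]^n≡1+b⇒a∣b {a} n eq =
  divides (geomSum (1 + a) n) (trans (sym (suc-injective (trans (sym ([1+b]^n≡1+b*geomSum a n)) eq)))
                                     (*-comm a _))

geomSum[1+b]-* : ∀ b a r →
  geomSum (1 + b) (a * r) ≡ geomSum (1 + b) a * geomSum (1 + b * geomSum (1 + b) a) r
geomSum[1+b]-* b a r =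
  trans (geomSum-* (1 + b) a r) (cong (λ x → geomSum (1 + b) a * geomSum x r) ([1+b]^n≡1+b*geomSum b a))

triangle : ℕ → ℕ
triangle zero    = 0
triangle (suc n) = n + triangle n

triangle-odd : ∀ h → triangle (1 + h * 2) ≡ (1 + h * 2) * h
triangle-odd zero    = refl
triangle-odd (suc h) = trans (cong (λ t → 2 + h * 2 + (1 + h * 2 + t)) (triangle-odd h)) (lemma h)
  where
  lemma : ∀ h → 2 + h * 2 + (1 + h * 2 + (1 + h * 2) * h) ≡ (3 + h * 2) * suc h
  lemma = solve-∀

-- (1 + b)^i ≡ 1 + i b (mod b²), summed over i < n.
geomSum-expansion : ∀ b n → ∃ λ z → geomSum (1 + b) n ≡ n + b * triangle n + b * b * z
geomSum-expansion b zero    = 0 , lemma b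
  where
  lemma : ∀ b → 0 ≡ 0 + b * 0 + b * b * 0
  lemma = solve-∀
geomSum-expansion b (suc n) with geomSum-expansion b n
... | z , eq = z + triangle n + b * z , trans (cong (λ s → 1 + (1 + b) * s) eq) (lemma b n (triangle n) z)
  where
  lemma : ∀ b n t z → 1 + (1 + b) * (n + b * t + b * b * z) ≡ suc n + b * (n + t) + b * b * (z + t + b * z)
  lemma = solve-∀

∤-geomSum : ∀ {l b r} → l ∣ b → ¬ l ∣ r → ¬ l ∣ geomSum (1 + b) r
∤-geomSum {l} {b} {r} l∣b l∤r l∣sum with geomSum-expansion b r
... | z , eq = l∤r (∣m+n∣m⇒∣n (subst (l ∣_) (trans eq (lemma r b (triangle r) z)) l∣sum) (∣-trans l∣b (m∣m*n _)))
  where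
  lemma : ∀ r b t z → r + b * t + b * b * z ≡ b * (t + b * z) + r
  lemma = solve-∀

prime⇒1< : ∀ {l} → Prime l → 1 < l
prime⇒1< {l} pl = nonTrivial⇒n>1 l {{prime⇒nonTrivial pl}}

prime∤1 : ∀ {l} → Prime l → ¬ l ∣ 1
prime∤1 pl l∣1 = ¬prime[1] (subst Prime (∣1⇒≡1 l∣1) pl)

prime∣2⇒≡2 : ∀ {l} → Prime l → l ∣ 2 → l ≡ 2
prime∣2⇒≡2 pl l∣2 with irreducible[2] l∣2
... | inj₁ refl = contradiction pl ¬prime[1]
... | inj₂ l≡2  = l≡2

prime≢2⇒odd : ∀ {l} → Prime l → l ≢ 2 → ∃ λ h → l ≡ 1 + h * 2
prime≢2⇒odd {l} pl l≢2 with l % 2 | m≡m%n+[m/n]*n l 2 | m%n<n l 2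
... | 0 | l≡ | _ with prime⇒irreducible pl (divides (l / 2) l≡)
...   | inj₁ ()
...   | inj₂ 2≡l = contradiction (sym 2≡l) l≢2
prime≢2⇒odd {l} pl l≢2 | 1 | l≡ | _ = l / 2 , l≡
prime≢2⇒odd {l} pl l≢2 | suc (suc _) | _ | s≤s (s≤s ())

record HasValuation (l k a : ℕ) : Set where
  constructor valuation
  field
    cofactor       : ℕ
    k≡l^a*cofactor : k ≡ l ^ a * cofactor
    l∤cofactor     : ¬ l ∣ cofactor

hasValuation-0 : ∀ {l k} → ¬ l ∣ k → HasValuation l k 0
hasValuation-0 {k = k} l∤k = valuation k (sym (*-identityˡ k)) l∤k

hasValuation-* : ∀ {l x y a b} → Prime l →
  HasValuation l x a → HasValuation l y b → HasValuation l (x * y) (a + b)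
hasValuation-* {l} {a = a} {b} pl (valuation r refl l∤r) (valuation s refl l∤s) =
  valuation (r * s) (trans (lemma (l ^ a) (l ^ b) r s) (cong (_* (r * s)) (sym (^-distribˡ-+-* l a b))))
            ([ l∤r , l∤s ] ∘ euclidsLemma r s pl)
  where
  lemma : ∀ p q r s → p * r * (q * s) ≡ p * q * (r * s)
  lemma = solve-∀

hasValuation⇒1≤ : ∀ {l k a} .{{_ : NonZero l}} → HasValuation l k a → 1 ≤ k
hasValuation⇒1≤ {l}         (valuation zero    _    l∤0) = contradiction (l ∣0) l∤0
hasValuation⇒1≤ {l} {a = a} (valuation (suc r) refl _)   = *-mono-≤ (m^n>0 l a) (s≤s z≤n)

hasValuation-unique : ∀ {l k a b} .{{_ : NonZero l}} → HasValuation l k a → HasValuation l k b → a ≡ b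
hasValuation-unique {a = zero}  {zero}  _ _ = refl
hasValuation-unique {l} {a = zero}  {suc b} (valuation r refl l∤r) (valuation s eq _) =
  contradiction (divides (l ^ b * s) (trans (sym (*-identityˡ r)) (trans eq (lemma l (l ^ b) s)))) l∤r
  where
  lemma : ∀ l p s → l * p * s ≡ p * s * l
  lemma = solve-∀
hasValuation-unique {l} {a = suc a} {zero} (valuation r eq _) (valuation s refl l∤s) =
  contradiction (divides (l ^ a * r) (trans (sym (*-identityˡ s)) (trans eq (lemma l (l ^ a) r)))) l∤s
  where
  lemma : ∀ l p s → l * p * s ≡ p * s * l
  lemma = solve-∀
hasValuation-unique {l} {a = suc a} {suc b} (valuation r eq₁ l∤r) (valuation s eq₂ l∤s) =
  cong suc (hasValuation-unique (valuation r refl l∤r) (valuation s cancel l∤s))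
  where
  cancel : l ^ a * r ≡ l ^ b * s
  cancel = *-cancelˡ-≡ _ _ l (trans (sym (*-assoc l _ r)) (trans (sym eq₁) (trans eq₂ (*-assoc l _ s))))

hasValuation-/ : ∀ {l k a} .{{_ : NonZero l}} → l ∣ k → HasValuation l (k / l) a → HasValuation l k (suc a)
hasValuation-/ {l} {k} {a} l∣k (valuation r k/l≡ l∤r) = valuation r k≡ l∤r
  where
  open ≡-Reasoning
  lemma : ∀ l p r → p * r * l ≡ l * p * r
  lemma = solve-∀
  k≡ : k ≡ l * l ^ a * r
  k≡ = begin
    k                ≡⟨ sym (m/n*n≡m l∣k) ⟩
    k / l * l        ≡⟨ cong (_* l) k/l≡ ⟩
    l ^ a * r * l    ≡⟨ lemma l (l ^ a) r ⟩
    l * l ^ a * r    ∎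

valF-hasValuation : ∀ p F k → 1 ≤ k → k ≤ F → HasValuation (2 + p) k (valF F (2 + p) k)
valF-hasValuation p (suc F) (suc k) _ (s≤s k≤F) with 2 + p ∣? suc k
... | no  l∤k = hasValuation-0 l∤k
... | yes l∣k = hasValuation-/ l∣k (valF-hasValuation p F (suc k / (2 + p)) 1≤k/l k/l≤F)
  where
  1≤k/l : 1 ≤ suc k / (2 + p)
  1≤k/l with suc k / (2 + p) | m/n*n≡m {suc k} {2 + p} l∣k
  ... | suc _ | _ = s≤s z≤n
  k/l≤F : suc k / (2 + p) ≤ F
  k/l≤F = s≤s⁻¹ (≤-trans (m/n<m (suc k) (2 + p) (s≤s (s≤s z≤n))) (s≤s k≤F))

v-hasValuation : ∀ {l k} → 1 < l → 1 ≤ k → HasValuation l k (v l k)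
v-hasValuation {suc (suc p)} {k} (s≤s (s≤s z≤n)) 1≤k = valF-hasValuation p k k 1≤k ≤-refl

hasValuation⇒v≡ : ∀ {l k a} → 1 < l → HasValuation l k a → v l k ≡ a
hasValuation⇒v≡ {suc (suc p)} 1<l@(s≤s (s≤s z≤n)) h = hasValuation-unique (v-hasValuation 1<l (hasValuation⇒1≤ h)) h

v-∤ : ∀ {l k} → 1 < l → ¬ l ∣ k → v l k ≡ 0
v-∤ 1<l l∤k = hasValuation⇒v≡ 1<l (hasValuation-0 l∤k)

∣⇒1≤v : ∀ {l k} → 1 < l → 1 ≤ k → l ∣ k → 1 ≤ v l k
∣⇒1≤v {l} {k} 1<l 1≤k l∣k with v l k | v-hasValuation 1<l 1≤k
... | zero  | valuation r k≡ l∤r = contradiction (subst (l ∣_) (trans k≡ (*-identityˡ r)) l∣k) l∤r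
... | suc _ | _                  = s≤s z≤n

v-* : ∀ {l x y} → Prime l → 1 ≤ x → 1 ≤ y → v l (x * y) ≡ v l x + v l y
v-* pl 1≤x 1≤y = hasValuation⇒v≡ (prime⇒1< pl)
  (hasValuation-* pl (v-hasValuation (prime⇒1< pl) 1≤x) (v-hasValuation (prime⇒1< pl) 1≤y))

-- The hypotheses of the lifting-the-exponent lemma for the prime l and x = 1 + b.
Liftable : ℕ → ℕ → Set
Liftable l b = (∃ λ h → l ≡ 1 + h * 2) × l ∣ b ⊎ l ≡ 2 × 4 ∣ b

Liftable⇒∣ : ∀ {l b} → Liftable l b → l ∣ b
Liftable⇒∣ (inj₁ (_ , l∣b))    = l∣b
Liftable⇒∣ (inj₂ (refl , 4∣b)) = ∣-trans (divides 2 refl) 4∣b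

Liftable-* : ∀ {l b} c → Liftable l b → Liftable l (b * c)
Liftable-* c (inj₁ (odd , l∣b))  = inj₁ (odd , ∣-trans l∣b (m∣m*n c))
Liftable-* c (inj₂ (l≡2 , 4∣b)) = inj₂ (l≡2 , ∣-trans 4∣b (m∣m*n c))

geomSum-self : ∀ {l b} → Liftable l b → ∃ λ w → geomSum (1 + b) l ≡ l * (1 + l * w)
geomSum-self (inj₁ ((h , refl) , divides c refl)) with geomSum-expansion (c * (1 + h * 2)) (1 + h * 2)
... | z , eq = c * h + c * c * z , trans eq (trans (cong (λ t → l + b * t + b * b * z) (triangle-odd h)) (lemma c h z))
  where
  l = 1 + h * 2
  b = c * l
  lemma : ∀ c h z → (1 + h * 2) + c * (1 + h * 2) * ((1 + h * 2) * h) + c * (1 + h * 2) * (c * (1 + h * 2)) * z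
                    ≡ (1 + h * 2) * (1 + (1 + h * 2) * (c * h + c * c * z))
  lemma = solve-∀
geomSum-self (inj₂ (refl , divides c refl)) = c , lemma c
  where
  lemma : ∀ c → 1 + (1 + c * 4) * (1 + (1 + c * 4) * 0) ≡ 2 * (1 + 2 * c)
  lemma = solve-∀

hasValuation-geomSum-self : ∀ {l b} → Prime l → Liftable l b → HasValuation l (geomSum (1 + b) l) 1
hasValuation-geomSum-self {l} pl lift with geomSum-self lift
... | w , eq = valuation (1 + l * w) (trans eq (cong (_* (1 + l * w)) (sym (*-identityʳ l))))
                         (λ l∣1+lw → prime∤1 pl (∣m+n∣m⇒∣n (subst (l ∣_) (+-comm 1 (l * w)) l∣1+lw) (m∣m*n w)))

hasValuation-geomSum-pow : ∀ {l b} → Prime l → Liftable l b → ∀ c → HasValuation l (geomSum (1 + b) (l ^ c)) c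
hasValuation-geomSum-pow {l} {b} pl lift zero =
  hasValuation-0 (prime∤1 pl ∘ subst (l ∣_) (cong suc (*-zeroʳ (1 + b))))
hasValuation-geomSum-pow {l} {b} pl lift (suc c) =
  subst (λ k → HasValuation l k (suc c)) (sym (geomSum[1+b]-* b l (l ^ c)))
    (hasValuation-* pl (hasValuation-geomSum-self pl lift)
      (hasValuation-geomSum-pow pl (Liftable-* (geomSum (1 + b) l) lift) c))

hasValuation-geomSum : ∀ {l b n c} → Prime l → Liftable l b → HasValuation l n c → HasValuation l (geomSum (1 + b) n) c
hasValuation-geomSum {l} {b} {c = c} pl lift (valuation r refl l∤r) =
  subst (λ k → HasValuation l k c) (sym (geomSum[1+b]-* b (l ^ c) r))
    (subst (HasValuation l _) (+-identityʳ c)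
      (hasValuation-* pl (hasValuation-geomSum-pow pl lift c)
        (hasValuation-0 (∤-geomSum (∣-trans (Liftable⇒∣ lift) (m∣m*n _)) l∤r))))

liftable⊎∤ : ∀ {l b n} → Prime l → l ∣ b → ¬ (l ≡ 2 × ¬ 4 ∣ b × 2 ∣ n) → Liftable l b ⊎ ¬ l ∣ n
liftable⊎∤ {l} {b} {n} pl l∣b ¬exc with l ≟ 2
... | no l≢2  = inj₁ (inj₁ (prime≢2⇒odd pl l≢2 , l∣b))
... | yes refl with 4 ∣? b | 2 ∣? n
...   | yes 4∣b | _       = inj₁ (inj₂ (refl , 4∣b))
...   | no  4∤b | yes 2∣n = contradiction (refl , 4∤b , 2∣n) ¬exc
...   | no  _   | no  2∤n = inj₂ 2∤n

v-geomSum : ∀ {l b n} → Prime l → l ∣ b → ¬ (l ≡ 2 × ¬ 4 ∣ b × 2 ∣ n) → 1 ≤ n →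
  v l (geomSum (1 + b) n) ≡ v l n
v-geomSum pl l∣b ¬exc 1≤n with liftable⊎∤ pl l∣b ¬exc
... | inj₁ lift = hasValuation⇒v≡ (prime⇒1< pl) (hasValuation-geomSum pl lift (v-hasValuation (prime⇒1< pl) 1≤n))
... | inj₂ l∤n  = trans (v-∤ (prime⇒1< pl) (∤-geomSum l∣b l∤n)) (sym (v-∤ (prime⇒1< pl) l∤n))

product-map-* : ∀ (f g : ℕ → ℕ) xs → product (map (λ x → f x * g x) xs) ≡ product (map f xs) * product (map g xs)
product-map-* f g []       = refl
product-map-* f g (x ∷ xs) =
  trans (cong (f x * g x *_) (product-map-* f g xs)) ([m*n]*[o*p]≡[m*o]*[n*p] (f x) (g x) _ _)

product-map-≡1 : ∀ (f : ℕ → ℕ) {xs} → All (λ x → f x ≡ 1) xs → product (map f xs) ≡ 1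
product-map-≡1 f []            = refl
product-map-≡1 f (fx≡1 ∷ fxs≡1) = cong₂ _*_ fx≡1 (product-map-≡1 f fxs≡1)

product-map-unique : ∀ (f : ℕ → ℕ) {x xs} → Unique xs → x ∈ xs → All (λ y → y ≢ x → f y ≡ 1) xs →
  product (map f xs) ≡ f x
product-map-unique f (x≢ys ∷ _) (here refl) (_ ∷ ys≡1) =
  trans (cong (f _ *_) (product-map-≡1 f (All.zipWith (λ (x≢y , y≡1) → y≡1 (x≢y ∘ sym)) (x≢ys , ys≡1))))
        (*-identityʳ _)
product-map-unique f (y≢ys ∷ ys-unique) (there x∈ys) (y≡1 ∷ ys≡1) =
  trans (cong₂ _*_ (y≡1 (All.lookup y≢ys x∈ys)) (product-map-unique f ys-unique x∈ys ys≡1)) (*-identityˡ _)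

primeDivisors-prime : ∀ d → All (λ l → Prime l × l ∣ d) (primeDivisors d)
primeDivisors-prime d = all-filter (λ l → prime? l ×-dec (l ∣? d)) (upTo (suc d))

dInf-cong : ∀ a b d → (∀ {l} → Prime l → l ∣ d → v l a ≡ v l b) → dInf a d ≡ dInf b d
dInf-cong a b d v≡ =
  cong product (map-cong-local (All.map (λ {l} (pl , l∣d) → cong (l ^_) (v≡ pl l∣d)) (primeDivisors-prime d)))

dInf-* : ∀ {a b} d → 1 ≤ a → 1 ≤ b → dInf (a * b) d ≡ dInf a d * dInf b d
dInf-* {a} {b} d 1≤a 1≤b =
  trans (cong product (map-cong-local (All.map (λ {l} (pl , _) → v-split pl) (primeDivisors-prime d))))
        (product-map-* (λ l → l ^ v l a) (λ l → l ^ v l b) (primeDivisors d))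
  where
  v-split : ∀ {l} → Prime l → l ^ v l (a * b) ≡ l ^ v l a * l ^ v l b
  v-split {l} pl = trans (cong (l ^_) (v-* pl 1≤a 1≤b)) (^-distribˡ-+-* l (v l a) (v l b))

dInf-2+ : ∀ {d b} → 1 ≤ d → 2 ∣ d → d ∣ b → dInf (2 + b) d ≡ 2 ^ v 2 (2 + b)
dInf-2+ {d} {b} 1≤d 2∣d d∣b =
  product-map-unique (λ l → l ^ v l (2 + b))
    (Unique.filter⁺ P? (Unique.upTo⁺ (suc d)))
    (∈-filter⁺ P? (∈-upTo⁺ (s≤s (∣⇒≤ {{>-nonZero 1≤d}} 2∣d))) (prime[2] , 2∣d))
    (All.map l≢2⇒l^v≡1 (primeDivisors-prime d))
  where
  P? = λ l → prime? l ×-dec (l ∣? d)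
  l≢2⇒l^v≡1 : ∀ {l} → Prime l × l ∣ d → l ≢ 2 → l ^ v l (2 + b) ≡ 1
  l≢2⇒l^v≡1 {l} (pl , l∣d) l≢2 = cong (l ^_) (v-∤ (prime⇒1< pl) l∤2+b)
    where
    l∤2+b : ¬ l ∣ 2 + b
    l∤2+b l∣2+b = l≢2 (prime∣2⇒≡2 pl (∣m+n∣m⇒∣n (subst (l ∣_) (+-comm 2 b) l∣2+b) (∣-trans l∣d d∣b)))

dInf-geomSum : ∀ {d b n} → 1 ≤ n → d ∣ b → ¬ (2 ∣ d × ¬ 4 ∣ b × 2 ∣ n) → dInf (geomSum (1 + b) n) d ≡ dInf n d
dInf-geomSum {d} {b} {n} 1≤n d∣b ¬exc = dInf-cong (geomSum (1 + b) n) n d (λ pl l∣d →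
  v-geomSum pl (∣-trans l∣d d∣b) (λ { (refl , 4∤b , 2∣n) → ¬exc (l∣d , 4∤b , 2∣n) }) 1≤n)

geomSum[1+b]-2 : ∀ b → geomSum (1 + b) 2 ≡ 2 + b
geomSum[1+b]-2 = lemma
  where
  lemma : ∀ b → 1 + (1 + b) * (1 + (1 + b) * 0) ≡ 2 + b
  lemma = solve-∀

dInf-2 : ∀ {d} → 1 ≤ d → 2 ∣ d → dInf 2 d ≡ 2
dInf-2 1≤d 2∣d = dInf-2+ 1≤d 2∣d (_ ∣0)

dInf-geomSum-even : ∀ {d b n} → 1 ≤ d → 1 ≤ n → d ∣ b → 2 ∣ d → 2 ∣ n →
  dInf (geomSum (1 + b) n) d ≡ dInf n d * 2 ^ (v 2 (2 + b) ∸ 1)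
dInf-geomSum-even {d} {b} 1≤d 1≤n d∣b 2∣d (divides (suc k) refl) = begin
  dInf (geomSum (1 + b) (suc k * 2)) d
    ≡⟨ cong (λ i → dInf (geomSum (1 + b) i) d) (*-comm (suc k) 2) ⟩
  dInf (geomSum (1 + b) (2 * suc k)) d
    ≡⟨ cong (λ x → dInf x d) sum≡ ⟩
  dInf ((2 + b) * geomSum (1 + b * (2 + b)) (suc k)) d
    ≡⟨ dInf-* d (s≤s z≤n) (s≤s z≤n) ⟩
  dInf (2 + b) d * dInf (geomSum (1 + b * (2 + b)) (suc k)) d
    ≡⟨ cong₂ _*_ (dInf-2+ 1≤d 2∣d d∣b) (dInf-geomSum (s≤s z≤n) (∣-trans d∣b (m∣m*n _)) λ (_ , 4∤ , _) → 4∤ 4∣b[2+b]) ⟩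
  2 ^ e * dInf (suc k) d
    ≡⟨ cong (λ i → 2 ^ i * dInf (suc k) d) (sym (m+[n∸m]≡n 1≤e)) ⟩
  2 * 2 ^ (e ∸ 1) * dInf (suc k) d
    ≡⟨ lemma 2 (2 ^ (e ∸ 1)) (dInf (suc k) d) ⟩
  2 * dInf (suc k) d * 2 ^ (e ∸ 1)
    ≡⟨ cong (λ x → x * dInf (suc k) d * 2 ^ (e ∸ 1)) (sym (dInf-2 1≤d 2∣d)) ⟩
  dInf 2 d * dInf (suc k) d * 2 ^ (e ∸ 1)
    ≡⟨ cong (_* 2 ^ (e ∸ 1)) (sym (dInf-* d (s≤s z≤n) (s≤s z≤n))) ⟩
  dInf (2 * suc k) d * 2 ^ (e ∸ 1)
    ≡⟨ cong (λ i → dInf i d * 2 ^ (e ∸ 1)) (*-comm 2 (suc k)) ⟩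
  dInf (suc k * 2) d * 2 ^ (e ∸ 1)  ∎
  where
  open ≡-Reasoning
  e = v 2 (2 + b)
  sum≡ : geomSum (1 + b) (2 * suc k) ≡ (2 + b) * geomSum (1 + b * (2 + b)) (suc k)
  sum≡ = trans (geomSum[1+b]-* b 2 (suc k))
               (cong₂ (λ x y → x * geomSum (1 + b * y) (suc k)) (geomSum[1+b]-2 b) (geomSum[1+b]-2 b))
  lemma : ∀ x y z → x * y * z ≡ x * z * y
  lemma = solve-∀
  2∣b : 2 ∣ b
  2∣b = ∣-trans 2∣d d∣b
  1≤e : 1 ≤ e
  1≤e = ∣⇒1≤v (s≤s (s≤s z≤n)) (s≤s z≤n) (∣m∣n⇒∣m+n (∣-refl {2}) 2∣b)
  4∣b[2+b] : 4 ∣ b * (2 + b)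
  4∣b[2+b] with 2∣b
  ... | divides β refl = divides (β * (1 + β)) (lemma′ β)
    where
    lemma′ : ∀ β → β * 2 * (2 + β * 2) ≡ β * (1 + β) * 4
    lemma′ = solve-∀

𝒫 : ℕ → ℕ → ℕ → Set
𝒫 d q f = TwoExactly d × q % 4 ≡ 3 × ¬ (2 ∣ f)

even⇒¬2∣[q^m∸1] : ∀ {q m b} → 1 ≤ m → 2 ∣ q → q ^ m ≡ 1 + b → ¬ 2 ∣ b
even⇒¬2∣[q^m∸1] {q} {suc m} {b} _ 2∣q q^m≡1+b 2∣b =
  contradiction (∣1⇒≡1 (∣m+n∣m⇒∣n (subst (2 ∣_) (trans q^m≡1+b (+-comm 1 b)) (∣-trans 2∣q (m∣m*n (q ^ m)))) 2∣b)) λ ()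

q%4≡3 : ∀ {q m b} → 1 ≤ m → q ^ m ≡ 1 + b → 2 ∣ b → ¬ 4 ∣ b → q % 4 ≡ 3
q%4≡3 {q} {m} {b} 1≤m q^m≡1+b 2∣b 4∤b with q % 4 | m≡m%n+[m/n]*n q 4 | m%n<n q 4
... | 0 | q≡ | _ = contradiction 2∣b (even⇒¬2∣[q^m∸1] 1≤m (divides (q / 4 * 2) (trans q≡ (sym (*-assoc (q / 4) 2 2)))) q^m≡1+b)
... | 1 | q≡ | _ = contradiction (∣-trans (n∣m*n (q / 4)) ([1+a]^n≡1+b⇒a∣b m (trans (cong (_^ m) (sym q≡)) q^m≡1+b))) 4∤b
... | 2 | q≡ | _ = contradiction 2∣b (even⇒¬2∣[q^m∸1] 1≤m (divides (1 + q / 4 * 2) (trans q≡ (lemma (q / 4)))) q^m≡1+b)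
  where
  lemma : ∀ t → 2 + t * 4 ≡ (1 + t * 2) * 2
  lemma = solve-∀
... | 3 | _ | _ = refl
... | suc (suc (suc (suc _))) | _ | s≤s (s≤s (s≤s (s≤s ())))

-- q ≡ 3 (mod 4) gives q² ≡ 1 (mod 4).
q%4≡3⇒¬2∣m : ∀ {q m b} → q % 4 ≡ 3 → q ^ m ≡ 1 + b → ¬ 4 ∣ b → ¬ 2 ∣ m
q%4≡3⇒¬2∣m {q} {m} {b} q%4≡3 q^m≡1+b 4∤b (divides j refl) =
  4∤b (∣-trans (n∣m*n X) ([1+a]^n≡1+b⇒a∣b j (begin
    (1 + X * 4) ^ j   ≡⟨ cong (_^ j) (sym q²≡) ⟩
    (q ^ 2) ^ j       ≡⟨ ^-*-assoc q 2 j ⟩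
    q ^ (2 * j)       ≡⟨ cong (q ^_) (*-comm 2 j) ⟩
    q ^ (j * 2)       ≡⟨ q^m≡1+b ⟩
    1 + b             ∎)))
  where
  open ≡-Reasoning
  t = q / 4
  X = 2 + 6 * t + 4 * t * t
  lemma : ∀ t → (3 + t * 4) * ((3 + t * 4) * 1) ≡ 1 + (2 + 6 * t + 4 * t * t) * 4
  lemma = solve-∀
  q²≡ : q ^ 2 ≡ 1 + X * 4
  q²≡ = trans (cong (λ x → x * (x * 1)) (trans (m≡m%n+[m/n]*n q 4) (cong (_+ t * 4) q%4≡3))) (lemma t)

pow≡1+[pow∸1] : ∀ q k → 1 ≤ q → q ^ k ≡ 1 + (q ^ k ∸ 1)
pow≡1+[pow∸1] q k 1≤q = sym (m+[n∸m]≡n (m^n>0 q {{>-nonZero 1≤q}} k))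

∣[1+R][1+D]^k∸1⇒∣R : ∀ {d} R D k → d ∣ D → d ∣ (1 + R) * (1 + D) ^ k ∸ 1 → d ∣ R
∣[1+R][1+D]^k∸1⇒∣R {d} R D k d∣D d∣ = ∣m+n∣m⇒∣n (subst (d ∣_) expand d∣) (∣-trans d∣D (m∣m*n _))
  where
  lemma : ∀ R D s → (1 + R) * (1 + D * s) ≡ 1 + (D * ((1 + R) * s) + R)
  lemma = solve-∀
  expand : (1 + R) * (1 + D) ^ k ∸ 1 ≡ D * ((1 + R) * geomSum (1 + D) k) + R
  expand = cong (_∸ 1) (trans (cong ((1 + R) *_) ([1+b]^n≡1+b*geomSum D k)) (lemma R D _))

IsOrd⇒∣ : ∀ {d q f m} → 1 ≤ q → IsOrd d q f → d ∣ q ^ m ∸ 1 → f ∣ m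
IsOrd⇒∣ {d} {q} {suc f} {m} 1≤q (_ , d∣D , minimal) d∣q^m∸1 = r≡0⇒f∣m (m % suc f) refl d∣R
  where
  r = m % suc f
  k = m / suc f
  D = q ^ suc f ∸ 1
  R = q ^ r ∸ 1
  q^m≡ : q ^ m ≡ (1 + R) * (1 + D) ^ k
  q^m≡ = begin
    q ^ m                       ≡⟨ cong (q ^_) (m≡m%n+[m/n]*n m (suc f)) ⟩
    q ^ (r + k * suc f)         ≡⟨ ^-distribˡ-+-* q r (k * suc f) ⟩
    q ^ r * q ^ (k * suc f)     ≡⟨ cong (λ i → q ^ r * q ^ i) (*-comm k (suc f)) ⟩
    q ^ r * q ^ (suc f * k)     ≡⟨ cong (q ^ r *_) (sym (^-*-assoc q (suc f) k)) ⟩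
    q ^ r * (q ^ suc f) ^ k     ≡⟨ cong₂ (λ x y → x * y ^ k) (pow≡1+[pow∸1] q r 1≤q) (pow≡1+[pow∸1] q (suc f) 1≤q) ⟩
    (1 + R) * (1 + D) ^ k       ∎
    where open ≡-Reasoning
  d∣R : d ∣ R
  d∣R = ∣[1+R][1+D]^k∸1⇒∣R R D k d∣D (subst (λ x → d ∣ x ∸ 1) q^m≡ d∣q^m∸1)
  r≡0⇒f∣m : ∀ r′ → r′ ≡ r → d ∣ q ^ r′ ∸ 1 → suc f ∣ m
  r≡0⇒f∣m zero     r′≡r _    = divides k (trans (m≡m%n+[m/n]*n m (suc f)) (cong (_+ k * suc f) (sym r′≡r)))
  r≡0⇒f∣m (suc r′) r′≡r d∣R′ = contradiction (minimal (suc r′) (s≤s z≤n) d∣R′) (<⇒≱ (subst (_< suc f) (sym r′≡r) (m%n<n m (suc f))))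
IsOrd⇒∣ {f = zero} _ (() , _) _

4∤[q^m∸1]⇒𝒫 : ∀ {d q m f b} → 1 ≤ q → 1 ≤ m → q ^ m ≡ 1 + b → d ∣ b → IsOrd d q f →
  2 ∣ d → ¬ 4 ∣ b → 𝒫 d q f
4∤[q^m∸1]⇒𝒫 {d} {q} {m} 1≤q 1≤m q^m≡1+b d∣b ord 2∣d 4∤b =
    (2∣d , λ 4∣d → 4∤b (∣-trans 4∣d d∣b))
  , q≡3
  , λ 2∣f → q%4≡3⇒¬2∣m {q} {m} q≡3 q^m≡1+b 4∤b (∣-trans 2∣f (IsOrd⇒∣ 1≤q ord d∣q^m∸1))
  where
  q≡3 : q % 4 ≡ 3
  q≡3 = q%4≡3 1≤m q^m≡1+b (∣-trans 2∣d d∣b) 4∤b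
  d∣q^m∸1 : d ∣ q ^ m ∸ 1
  d∣q^m∸1 = subst (λ x → d ∣ x ∸ 1) (sym q^m≡1+b) d∣b

lemma6p1 : (d m n q f : ℕ) → 1 ≤ d → 1 ≤ m → 1 ≤ n → 2 ≤ q →
    gcd d q ≡ 1 → d ∣ (q ^ m ∸ 1) → IsOrd d q f →
    ((TwoExactly d × q % 4 ≡ 3 × ¬ (2 ∣ f)) × 2 ∣ n →
      dInf (q ^ (m * n) ∸ 1) d ≡ dInf (q ^ m ∸ 1) d * dInf n d * 2 ^ (v 2 (q ^ m + 1) ∸ 1)) ×
    (¬ ((TwoExactly d × q % 4 ≡ 3 × ¬ (2 ∣ f)) × 2 ∣ n) →
      dInf (q ^ (m * n) ∸ 1) d ≡ dInf (q ^ m ∸ 1) d * dInf n d)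
lemma6p1 d m n q f 1≤d 1≤m 1≤n 2≤q _ d∣b ord =
    (λ { (((2∣d , _) , _) , 2∣n) → begin
      dInf (q ^ (m * n) ∸ 1) d                        ≡⟨ factor ⟩
      dInf b d * dInf (geomSum (1 + b) n) d           ≡⟨ cong (dInf b d *_) (dInf-geomSum-even 1≤d 1≤n d∣b 2∣d 2∣n) ⟩
      dInf b d * (dInf n d * 2 ^ (v 2 (2 + b) ∸ 1))   ≡⟨ sym (*-assoc (dInf b d) _ _) ⟩
      dInf b d * dInf n d * 2 ^ (v 2 (2 + b) ∸ 1)     ≡⟨ cong (λ x → dInf b d * dInf n d * 2 ^ (v 2 x ∸ 1)) (sym q^m+1≡2+b) ⟩
      dInf b d * dInf n d * 2 ^ (v 2 (q ^ m + 1) ∸ 1) ∎ })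
  , λ ¬𝒫∧2∣n → trans factor (cong (dInf b d *_) (dInf-geomSum 1≤n d∣b
      (λ (2∣d , 4∤b , 2∣n) → ¬𝒫∧2∣n (4∤[q^m∸1]⇒𝒫 1≤q 1≤m q^m≡1+b d∣b ord 2∣d 4∤b , 2∣n))))
  where
  open ≡-Reasoning
  b = q ^ m ∸ 1
  1≤q : 1 ≤ q
  1≤q = <⇒≤ 2≤q
  q^m≡1+b : q ^ m ≡ 1 + b
  q^m≡1+b = pow≡1+[pow∸1] q m 1≤q
  q^m+1≡2+b : q ^ m + 1 ≡ 2 + b
  q^m+1≡2+b = trans (cong (_+ 1) q^m≡1+b) (+-comm (1 + b) 1)
  1≤b : 1 ≤ b
  1≤b = s≤s⁻¹ (subst (1 <_) q^m≡1+b (^-monoʳ-< q 2≤q 1≤m))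
  factor : dInf (q ^ (m * n) ∸ 1) d ≡ dInf b d * dInf (geomSum (1 + b) n) d
  factor = begin
    dInf (q ^ (m * n) ∸ 1) d               ≡⟨ cong (λ x → dInf (x ∸ 1) d) (sym (^-*-assoc q m n)) ⟩
    dInf ((q ^ m) ^ n ∸ 1) d               ≡⟨ cong (λ x → dInf (x ^ n ∸ 1) d) q^m≡1+b ⟩
    dInf ((1 + b) ^ n ∸ 1) d               ≡⟨ cong (λ x → dInf (x ∸ 1) d) ([1+b]^n≡1+b*geomSum b n) ⟩
    dInf (b * geomSum (1 + b) n) d         ≡⟨ dInf-* d 1≤b (1≤geomSum 1≤n) ⟩
    dInf b d * dInf (geomSum (1 + b) n) d  ∎
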